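{- Let $b\ge 2$, and let $N$ be a $b$-ARH number with $k$ digits in base $b$ and with additive multiplier $M$. Then $k\le M+2$ if $b\ge 4$, and $k\le M+3$ if $b=2$ or $b=3$.
   Context: For a positive integer $N$, $s_b(N)$ is the sum of the base-$b$ digits of $N$, and the reversal $N^R$ is the integer obtained by writing the base-$b$ digits of $N$ in reverse order. A positive integer $N$ is a $b$-ARH number if there exists a positive integer $M$ (called an additive multiplier of $N$) such that $N=Ms_b(N)+(Ms_b(N))^R$. -}

module Defs where

open import Data.Nat using (ℕ; zero; suc; _+_; _*_; _≤_; _<_; NonZero)
open import Data.Nat.DivMod using (_/_; _%_)
open import Data.List using (List; []; _∷_; length; reverse)
open import Data.Nat.ListAction using (sum)
open import Data.Product using (Σ; _×_)
open import Relation.Binary.PropositionalEquality using (_≡_)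

-- Little-endian base-b digits of n, computed with fuel (fuel n suffices for b ≥ 2).
digitsFuel : (b : ℕ) → .{{NonZero b}} → ℕ → ℕ → List ℕ
digitsFuel b zero    n       = []
digitsFuel b (suc f) zero    = []
digitsFuel b (suc f) (suc m) = (suc m % b) ∷ digitsFuel b f (suc m / b)

-- base-b digits of n, least significant first (empty list for n = 0)
digits : (b : ℕ) → .{{NonZero b}} → ℕ → List ℕ
digits b n = digitsFuel b n n

fromDigits : ℕ → List ℕ → ℕ
fromDigits b []       = 0
fromDigits b (d ∷ ds) = d + b * fromDigits b ds

numDigits : (b : ℕ) → .{{NonZero b}} → ℕ → ℕ
numDigits b n = length (digits b n)

digitSum : (b : ℕ) → .{{NonZero b}} → ℕ → ℕ
digitSum b n = sum (digits b n)

rev : (b : ℕ) → .{{NonZero b}} → ℕ → ℕ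
rev b n = fromDigits b (reverse (digits b n))

IsAdditiveMultiplier : (b : ℕ) → .{{NonZero b}} → ℕ → ℕ → Set
IsAdditiveMultiplier b N M = 1 ≤ M × N ≡ M * digitSum b N + rev b (M * digitSum b N)

module Submission where

-- Let N have k base-b digits and put P = M·s_b(N), so that N = P + P^R.
-- If P has L digits then so has (at most) P^R, hence N < 2·b^L ≤ b^(L+1)
-- and k ≤ L + 1.  As P ≥ b^(L-1), this gives the key inequality
--     b^(k-2) ≤ P = M·s_b(N) ≤ M·(b-1)·k.
-- The left side is exponential in k and the right side only quadratic once
-- M is small compared to k, which forces k ≤ M + 2 (b ≥ 4) or k ≤ M + 3
-- (b = 2, 3; for these bases the exponential takes one more digit to win).

open import Defs
open import Data.Nat using (ℕ; zero; suc; _+_; _*_; _∸_; _^_; _≤_; _<_; z≤n; s≤s; NonZero; _≤?_)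
open import Data.Nat.Properties
open import Data.Nat.DivMod using (_/_; _%_; m%n<n; m≡m%n+[m/n]*n; m/n<m)
open import Data.List using ([]; _∷_; length; reverse)
open import Data.List.Properties using (length-reverse)
open import Data.List.Relation.Unary.All using (All; []; _∷_)
open import Data.List.Relation.Binary.Permutation.Propositional using (↭-sym)
open import Data.List.Relation.Binary.Permutation.Propositional.Properties using (All-resp-↭; ↭-reverse)
open import Data.Nat.ListAction using (sum)
open import Data.Product using (_×_; _,_)
open import Relation.Nullary using (yes; no; contradiction)
open import Relation.Binary.PropositionalEquality using (_≡_; refl; sym; cong; subst)
open import Data.Nat.Tactic.RingSolver using (solve-∀)
open import Algebra.Properties.CommutativeSemigroup *-commutativeSemigroup using (x∙yz≈y∙xz)

module _ (b : ℕ) .{{_ : NonZero b}} where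

  digitsFuel-< : ∀ f n → All (_< b) (digitsFuel b f n)
  digitsFuel-< zero    n       = []
  digitsFuel-< (suc f) zero    = []
  digitsFuel-< (suc f) (suc m) = m%n<n (suc m) b ∷ digitsFuel-< f (suc m / b)

  sum-digits-≤ : ∀ ds → All (_< b) ds → sum ds ≤ (b ∸ 1) * length ds
  sum-digits-≤ []       []          = z≤n
  sum-digits-≤ (d ∷ ds) (d<b ∷ ds<b) =
    subst (d + sum ds ≤_) (sym (*-suc (b ∸ 1) (length ds)))
      (+-mono-≤ (<⇒≤pred d<b) (sum-digits-≤ ds ds<b))

  fromDigits-< : ∀ ds → All (_< b) ds → fromDigits b ds < b ^ length ds
  fromDigits-< []       []           = s≤s z≤n
  fromDigits-< (d ∷ ds) (d<b ∷ ds<b) = begin-strict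
      d + b * x          <⟨ +-monoˡ-< (b * x) d<b ⟩
      b + b * x          ≡⟨ sym (*-suc b x) ⟩
      b * suc x          ≤⟨ *-monoʳ-≤ b (fromDigits-< ds ds<b) ⟩
      b * b ^ length ds  ∎
    where
      open ≤-Reasoning
      x = fromDigits b ds

  digitsFuel-lower : ∀ f n L → length (digitsFuel b f n) ≡ suc L → b ^ L ≤ n
  digitsFuel-lower zero    n       L       ()
  digitsFuel-lower (suc f) zero    L       ()
  digitsFuel-lower (suc f) (suc m) zero    _  = s≤s z≤n
  digitsFuel-lower (suc f) (suc m) (suc L) eq = begin
      b * b ^ L          ≤⟨ *-monoʳ-≤ b (digitsFuel-lower f q L (suc-injective eq)) ⟩
      b * q              ≡⟨ *-comm b q ⟩
      q * b              ≤⟨ m≤n+m (q * b) (suc m % b) ⟩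
      suc m % b + q * b  ≡⟨ sym (m≡m%n+[m/n]*n (suc m) b) ⟩
      suc m              ∎
    where
      open ≤-Reasoning
      q = suc m / b

  digitsFuel-upper : 2 ≤ b → ∀ f n → n ≤ f → n < b ^ length (digitsFuel b f n)
  digitsFuel-upper 2≤b zero    zero    _         = s≤s z≤n
  digitsFuel-upper 2≤b (suc f) zero    _         = s≤s z≤n
  digitsFuel-upper 2≤b (suc f) (suc m) (s≤s m≤f) = begin-strict
      suc m                                ≡⟨ m≡m%n+[m/n]*n (suc m) b ⟩
      suc m % b + q * b                    <⟨ +-monoˡ-< (q * b) (m%n<n (suc m) b) ⟩
      b + q * b                            ≡⟨ cong (b +_) (*-comm q b) ⟩
      b + b * q                            ≡⟨ sym (*-suc b q) ⟩
      b * suc q                            ≤⟨ *-monoʳ-≤ b (digitsFuel-upper 2≤b f q q≤f) ⟩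
      b * b ^ length (digitsFuel b f q)    ∎
    where
      open ≤-Reasoning
      q = suc m / b
      q≤f : q ≤ f
      q≤f = ≤-trans (<⇒≤pred (m/n<m (suc m) b 2≤b)) m≤f

  numDigits-lower : ∀ n → 1 ≤ n → b ^ (numDigits b n ∸ 1) ≤ n
  numDigits-lower (suc m) _ = digitsFuel-lower (suc m) (suc m) _ refl

  numDigits-upper : 2 ≤ b → ∀ n → n < b ^ numDigits b n
  numDigits-upper 2≤b n = digitsFuel-upper 2≤b n n ≤-refl

  numDigits-≤ : ∀ n L → n < b ^ L → numDigits b n ≤ L
  numDigits-≤ zero    L _    = z≤n
  numDigits-≤ (suc m) L n<bᴸ = ≰⇒> λ L≤k-1 →
    <⇒≱ n<bᴸ (≤-trans (^-monoʳ-≤ b L≤k-1) (numDigits-lower (suc m) (s≤s z≤n)))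

  rev-< : ∀ n → rev b n < b ^ numDigits b n
  rev-< n = subst (λ L → rev b n < b ^ L) (length-reverse ds)
              (fromDigits-< (reverse ds) (All-resp-↭ (↭-sym (↭-reverse ds)) (digitsFuel-< n n)))
    where ds = digits b n

  numDigits-+rev : 2 ≤ b → ∀ P → numDigits b (P + rev b P) ≤ suc (numDigits b P)
  numDigits-+rev 2≤b P = numDigits-≤ (P + rev b P) (suc L) (begin-strict
      P + rev b P        <⟨ +-mono-< (numDigits-upper 2≤b P) (rev-< P) ⟩
      b ^ L + b ^ L      ≡⟨ cong (b ^ L +_) (sym (+-identityʳ (b ^ L))) ⟩
      2 * b ^ L          ≤⟨ *-monoˡ-≤ (b ^ L) 2≤b ⟩
      b ^ suc L          ∎)
    where
      open ≤-Reasoning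
      L = numDigits b P

  reversal-sum-lower : 2 ≤ b → ∀ {N} P → 1 ≤ N → N ≡ P + rev b P → b ^ (numDigits b N ∸ 2) ≤ P
  reversal-sum-lower 2≤b zero      () refl
  reversal-sum-lower 2≤b P@(suc _) _  refl = begin
      b ^ (numDigits b (P + rev b P) ∸ 2)  ≤⟨ ^-monoʳ-≤ b (∸-monoˡ-≤ 2 (numDigits-+rev 2≤b P)) ⟩
      b ^ (numDigits b P ∸ 1)              ≤⟨ numDigits-lower P (s≤s z≤n) ⟩
      P                                    ∎
    where open ≤-Reasoning

  arh-key-inequality : 2 ≤ b → ∀ N M → 1 ≤ N →
    N ≡ M * digitSum b N + rev b (M * digitSum b N) →
    b ^ (numDigits b N ∸ 2) ≤ M * ((b ∸ 1) * numDigits b N)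
  arh-key-inequality 2≤b N M 1≤N eq =
    ≤-trans (reversal-sum-lower 2≤b (M * digitSum b N) 1≤N eq)
            (*-monoʳ-≤ M (sum-digits-≤ (digits b N) (digitsFuel-< N N)))

geometric-bound : ∀ c (p : ℕ → ℕ) → (∀ i → p (suc i) ≤ c * p i) → ∀ i → p i ≤ p 0 * c ^ i
geometric-bound c p step zero    = ≤-reflexive (sym (*-identityʳ (p 0)))
geometric-bound c p step (suc i) = begin
    p (suc i)            ≤⟨ step i ⟩
    c * p i              ≤⟨ *-monoʳ-≤ c (geometric-bound c p step i) ⟩
    c * (p 0 * c ^ i)    ≡⟨ x∙yz≈y∙xz c (p 0) (c ^ i) ⟩
    p 0 * (c * c ^ i)    ∎
  where open ≤-Reasoning

slack⇒≤ : ∀ m d {n} → m + d ≡ n → m ≤ n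
slack⇒≤ m d refl = m≤m+n m d

-- The quadratic i(i+3) is dominated by 4^i (the ratio of consecutive values
-- of (i+1)(i+4) is at most 4).
quadratic≤4^ : ∀ i → i * (3 + i) ≤ 4 ^ i
quadratic≤4^ zero    = z≤n
quadratic≤4^ (suc i) = geometric-bound 4 p step i
  where
    p : ℕ → ℕ
    p j = (1 + j) * (4 + j)
    identity : ∀ j → (2 + j) * (5 + j) + (3 * (j * j) + 13 * j + 6) ≡ 4 * ((1 + j) * (4 + j))
    identity = solve-∀
    step : ∀ j → p (suc j) ≤ 4 * p j
    step j = slack⇒≤ _ _ (identity j)

-- Growth for b ≥ 4: with k = i + 3 digits and M ≤ i, M·(b-1)·k < b^(k-2).
large-base-growth : ∀ b → 4 ≤ b → ∀ i → i * ((b ∸ 1) * (3 + i)) < b ^ (1 + i)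
large-base-growth b@(suc b-1) 4≤b i = begin-strict
    i * (b-1 * (3 + i))   ≡⟨ x∙yz≈y∙xz i b-1 (3 + i) ⟩
    b-1 * (i * (3 + i))   ≤⟨ *-monoʳ-≤ b-1 (≤-trans (quadratic≤4^ i) (^-monoˡ-≤ i 4≤b)) ⟩
    b-1 * b ^ i           <⟨ *-monoˡ-< (b ^ i) {{m^n≢0 b i}} (n<1+n b-1) ⟩
    b * b ^ i             ∎
  where open ≤-Reasoning

-- Growth for b = 2 with k = i + 4: the factor (i+2)(i+6) at most doubles per
-- step, and the cases i = 0, 1 are checked directly.
base2-growth : ∀ i → i * (1 * (4 + i)) < 2 ^ (2 + i)
base2-growth zero          = s≤s z≤n
base2-growth (suc zero)    = s≤s (s≤s (s≤s (s≤s (s≤s (s≤s z≤n)))))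
base2-growth (suc (suc i)) = begin-strict
    p i           ≤⟨ geometric-bound 2 p step i ⟩
    12 * 2 ^ i    <⟨ *-monoˡ-< (2 ^ i) {{m^n≢0 2 i}} (m≤m+n 13 3) ⟩
    16 * 2 ^ i    ≡⟨ sym (^-distribˡ-+-* 2 4 i) ⟩
    2 ^ (4 + i)   ∎
  where
    open ≤-Reasoning
    p : ℕ → ℕ
    p j = (2 + j) * (1 * (6 + j))
    identity : ∀ j → (3 + j) * (1 * (7 + j)) + (j * j + 6 * j + 3) ≡ 2 * ((2 + j) * (1 * (6 + j)))
    identity = solve-∀
    step : ∀ j → p (suc j) ≤ 2 * p j
    step j = slack⇒≤ _ _ (identity j)

-- Growth for b = 3 with k = i + 4: the factor 2(i+1)(i+5) at most triples.
base3-growth : ∀ i → i * (2 * (4 + i)) < 3 ^ (2 + i)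
base3-growth zero    = s≤s z≤n
base3-growth (suc i) = begin-strict
    p i           ≤⟨ geometric-bound 3 p step i ⟩
    10 * 3 ^ i    <⟨ *-monoˡ-< (3 ^ i) {{m^n≢0 3 i}} (m≤m+n 11 16) ⟩
    27 * 3 ^ i    ≡⟨ sym (^-distribˡ-+-* 3 3 i) ⟩
    3 ^ (3 + i)   ∎
  where
    open ≤-Reasoning
    p : ℕ → ℕ
    p j = (1 + j) * (2 * (5 + j))
    identity : ∀ j → (2 + j) * (2 * (6 + j)) + (4 * (j * j) + 20 * j + 6) ≡ 3 * ((1 + j) * (2 * (5 + j)))
    identity = solve-∀
    step : ∀ j → p (suc j) ≤ 3 * p j
    step j = slack⇒≤ _ _ (identity j)

small-base-growth : ∀ b → 2 ≤ b → b < 4 → ∀ i → i * ((b ∸ 1) * (4 + i)) < b ^ (2 + i)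
small-base-growth 1 (s≤s ()) _
small-base-growth 2 _ _ = base2-growth
small-base-growth 3 _ _ = base3-growth
small-base-growth (suc (suc (suc (suc _)))) _ (s≤s (s≤s (s≤s (s≤s ()))))

-- If the key inequality b^(k-2) ≤ M·(b-1)·k holds while the exponential beats
-- the quadratic on every k = d+1+i, then k ≤ M + d: otherwise M ≤ k - (d+1).
few-digits : ∀ b M k d →
  (∀ i → i * ((b ∸ 1) * (suc d + i)) < b ^ (suc d + i ∸ 2)) →
  b ^ (k ∸ 2) ≤ M * ((b ∸ 1) * k) → k ≤ M + d
few-digits b M k d growth key with k ≤? M + d
... | yes k≤M+d = k≤M+d
... | no  k≰M+d = contradiction key (<⇒≱ (subst (λ n → M * ((b ∸ 1) * n) < b ^ (n ∸ 2)) k≡ bound))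
  where
    excess : M + suc d ≤ k
    excess = subst (_≤ k) (sym (+-suc M d)) (≰⇒> k≰M+d)
    i : ℕ
    i = k ∸ suc d
    k≡ : suc d + i ≡ k
    k≡ = m+[n∸m]≡n (m+n≤o⇒n≤o M excess)
    bound : M * ((b ∸ 1) * (suc d + i)) < b ^ (suc d + i ∸ 2)
    bound = ≤-<-trans (*-monoˡ-≤ _ (m+n≤o⇒m≤o∸n M excess)) (growth i)

theorem35 : (b : ℕ) → .{{_ : NonZero b}} → 2 ≤ b → (N M : ℕ) → 1 ≤ N →
            IsAdditiveMultiplier b N M →
            (4 ≤ b → numDigits b N ≤ M + 2) × (b < 4 → numDigits b N ≤ M + 3)
theorem35 b 2≤b N M 1≤N (_ , N≡) =
    (λ 4≤b → few-digits b M k 2 (large-base-growth b 4≤b) key)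
  , (λ b<4 → few-digits b M k 3 (small-base-growth b 2≤b b<4) key)
  where
    k = numDigits b N
    key : b ^ (k ∸ 2) ≤ M * ((b ∸ 1) * k)
    key = arh-key-inequality b 2≤b N M 1≤N N≡
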